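{- Let $\nu$, $b$, $c$ and $t$ be positive integers with $2\nu\ge 2b+c+1$, $\nu>b\ge t+1$ and $c\ge t$. For $x\in\{t,\dots,b\}$ let $$g_{b,c}(x)={x\brack t}{c-t+1\brack 1}^{x-t}N'(x;b;2\nu).$$ Then $g_{b,c}(x)$ is strictly decreasing in $x$ on $\{t,\dots,b\}$.
   Context: $q$ is a prime power. The Gaussian binomial coefficient is ${n\brack k}=\prod_{0\le i<k}\frac{q^{n-i}-1}{q^{k-i}-1}$. For $a\le m\le\nu$, $N'(a;m;2\nu)=\prod_{i=1}^{m-a}\frac{q^{2(\nu-m+i)}-1}{q^i-1}$, which is the number of $m$-dimensional totally isotropic subspaces containing a fixed $a$-dimensional totally isotropic subspace in $\mathbb{F}_q^{2\nu}$ with a non-degenerate alternating form. -}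

module Defs where

open import Data.Nat using (ℕ; zero; suc; _+_; _*_; _∸_; _^_; _≤_; _<_)
open import Data.Nat.Primality using (Prime)
open import Data.Product using (Σ; _×_)
open import Relation.Binary.PropositionalEquality using (_≡_)
open import Data.Integer using (+_)
open import Data.Rational using (ℚ; _/_; 0ℚ; 1ℚ) renaming (_*_ to _*ℚ_)

IsPrimePower : ℕ → Set
IsPrimePower q = Σ ℕ λ p → Σ ℕ λ k → Prime p × (1 ≤ k) × (q ≡ p ^ k)

-- exact rational quotient m / n of naturals; the n = 0 branch never
-- arises in this file's uses (denominators are q^i - 1 with q ≥ 2, i ≥ 1)
_÷ℕ_ : ℕ → ℕ → ℚ
m ÷ℕ zero  = 0ℚ
m ÷ℕ suc n = (+ m) / suc n

prodℚ : ℕ → (ℕ → ℚ) → ℚ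
prodℚ zero    f = 1ℚ
prodℚ (suc n) f = prodℚ n f *ℚ f n

gauss : ℕ → ℕ → ℕ → ℚ
gauss q n k = prodℚ k (λ i → (q ^ (n ∸ i) ∸ 1) ÷ℕ (q ^ (k ∸ i) ∸ 1))

-- N'(a; m; 2ν) = ∏_{i=1}^{m-a} (q^(2(ν-m+i)) - 1) / (q^i - 1)
-- (index shifted: j = i - 1 ranges over 0 .. m-a-1); used with a ≤ m ≤ ν
N′ : ℕ → ℕ → ℕ → ℕ → ℚ
N′ q a m ν = prodℚ (m ∸ a) (λ j → (q ^ (2 * (ν ∸ m + suc j)) ∸ 1) ÷ℕ (q ^ suc j ∸ 1))

powℚ : ℚ → ℕ → ℚ
powℚ x zero    = 1ℚ
powℚ x (suc n) = powℚ x n *ℚ x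

g : ℕ → ℕ → ℕ → ℕ → ℕ → ℕ → ℚ
g q ν b c t x = gauss q x t *ℚ powℚ (gauss q (c ∸ t + 1) 1) (x ∸ t) *ℚ N′ q x b ν

-- Write [m] = q^m − 1.  Between consecutive x each of the three factors of g changes by a single
-- factor, so that
--   g(x+1) / g(x) = [x+1] [c−t+1] [b−x] / ([x+1−t] [1] [2(ν−x)]).
-- Bounding [i+j] ≤ q^(i+1) [j] for the first two factors of the numerator and
-- [m] q^n < q^m [n] for the third, the ratio is less than q^(c+2+b−x−2(ν−x)) ≤ 1,
-- because x < b and 2ν ≥ 2b + c + 1.

module Submission where

open import Defs
open import Data.Nat using (ℕ; _+_; _*_; _≤_; _<_; _≥_; _>_)
open import Data.Rational using (ℚ) renaming (_<_ to _<ℚ_)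

open import Algebra.Bundles using (CommutativeMonoid)
import Algebra.Properties.CommutativeSemigroup as CommSemigroupProperties
open import Data.Integer using (+_)
import Data.Integer as ℤ
import Data.Integer.Properties as ℤP
open import Data.Nat using (zero; suc; _∸_; _^_; z≤n; s≤s; nonTrivial⇒n>1; >-nonZero; _≤′_; ≤′-refl; ≤′-step)
open import Data.Nat.Primality using (prime⇒nonTrivial)
open import Data.Nat.Properties
open import Data.Nat.Solver using (module +-*-Solver)
open import Data.Product using (_,_)
open import Data.Rational using (Positive; 1ℚ; toℚᵘ) renaming (_*_ to _*ℚ_)
import Data.Rational.Properties as ℚ
open import Data.Rational.Unnormalised using (mkℚᵘ; *≡*; *<*) renaming (_≃_ to _≃ᵘ_; _*_ to _*ᵘ_)
import Data.Rational.Unnormalised.Properties as ℚᵘ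
open import Relation.Binary.Definitions using (Transitive)
open import Relation.Binary.PropositionalEquality

open +-*-Solver using (solve; _:+_; _:*_; _:=_; con)

module ℚ* = CommSemigroupProperties (CommutativeMonoid.commutativeSemigroup ℚ.*-1-commutativeMonoid)

fromℕ : ℕ → ℚ
fromℕ n = n ÷ℕ 1

toℚᵘ-÷ℕ : ∀ a d → toℚᵘ (a ÷ℕ suc d) ≃ᵘ mkℚᵘ (+ a) d
toℚᵘ-÷ℕ a d = ℚ.toℚᵘ-fromℚᵘ (mkℚᵘ (+ a) d)

÷ℕ-*-÷ℕ : ∀ a b c d → (a ÷ℕ suc b) *ℚ (c ÷ℕ suc d) ≡ (a * c) ÷ℕ (suc b * suc d)
÷ℕ-*-÷ℕ a b c d = ℚ.toℚᵘ-injective (begin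
  toℚᵘ ((a ÷ℕ suc b) *ℚ (c ÷ℕ suc d))               ≈⟨ ℚ.toℚᵘ-homo-* (a ÷ℕ suc b) (c ÷ℕ suc d) ⟩
  toℚᵘ (a ÷ℕ suc b) *ᵘ toℚᵘ (c ÷ℕ suc d)             ≈⟨ ℚᵘ.*-cong (toℚᵘ-÷ℕ a b) (toℚᵘ-÷ℕ c d) ⟩
  mkℚᵘ (+ a ℤ.* + c) (suc b * suc d ∸ 1)            ≈⟨ *≡* (cong (ℤ._* + (suc b * suc d)) (sym (ℤP.pos-* a c))) ⟩
  mkℚᵘ (+ (a * c)) (suc b * suc d ∸ 1)              ≈⟨ ℚᵘ.≃-sym (toℚᵘ-÷ℕ (a * c) (suc b * suc d ∸ 1)) ⟩
  toℚᵘ ((a * c) ÷ℕ (suc b * suc d))                 ∎)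
  where open ℚᵘ.≃-Reasoning

÷ℕ-cong : ∀ a b c d → a * suc d ≡ c * suc b → a ÷ℕ suc b ≡ c ÷ℕ suc d
÷ℕ-cong a b c d eq = ℚ.fromℚᵘ-cong {mkℚᵘ (+ a) b} {mkℚᵘ (+ c) d} (*≡* (begin
  + a ℤ.* + suc d  ≡⟨ sym (ℤP.pos-* a (suc d)) ⟩
  + (a * suc d)    ≡⟨ cong +_ eq ⟩
  + (c * suc b)    ≡⟨ ℤP.pos-* c (suc b) ⟩
  + c ℤ.* + suc b  ∎))
  where open ≡-Reasoning

÷ℕ-< : ∀ a b c d → a * suc d < c * suc b → a ÷ℕ suc b <ℚ c ÷ℕ suc d
÷ℕ-< a b c d lt = ℚ.toℚᵘ-cancel-<
  (ℚᵘ.<-respˡ-≃ (ℚᵘ.≃-sym (toℚᵘ-÷ℕ a b)) (ℚᵘ.<-respʳ-≃ (ℚᵘ.≃-sym (toℚᵘ-÷ℕ c d))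
    (*<* (subst₂ ℤ._<_ (ℤP.pos-* a (suc d)) (ℤP.pos-* c (suc b)) (ℤ.+<+ lt)))))

÷ℕ-pos : ∀ {a d} → 1 ≤ a → 1 ≤ d → Positive (a ÷ℕ d)
÷ℕ-pos {suc a} {suc d} _ _ = ℚ.normalize-pos (suc a) (suc d)

fromℕ-* : ∀ m n → fromℕ (m * n) ≡ fromℕ m *ℚ fromℕ n
fromℕ-* m n = sym (÷ℕ-*-÷ℕ m 0 n 0)

fromℕ-< : ∀ {m n} → m < n → fromℕ m <ℚ fromℕ n
fromℕ-< {m} {n} m<n = ÷ℕ-< m 0 n 0 (subst₂ _<_ (sym (*-identityʳ m)) (sym (*-identityʳ n)) m<n)

÷ℕ-*-fromℕ : ∀ a d n → (a ÷ℕ d) *ℚ fromℕ n ≡ (a * n) ÷ℕ d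
÷ℕ-*-fromℕ a zero    n = ℚ.*-zeroˡ (fromℕ n)
÷ℕ-*-fromℕ a (suc d) n = trans (÷ℕ-*-÷ℕ a d n 0) (cong ((a * n) ÷ℕ_) (*-identityʳ (suc d)))

÷ℕ-*-fromℕ-comm : ∀ a b d → (a ÷ℕ d) *ℚ fromℕ b ≡ (b ÷ℕ d) *ℚ fromℕ a
÷ℕ-*-fromℕ-comm a b d = begin
  (a ÷ℕ d) *ℚ fromℕ b  ≡⟨ ÷ℕ-*-fromℕ a d b ⟩
  (a * b) ÷ℕ d         ≡⟨ cong (_÷ℕ d) (*-comm a b) ⟩
  (b * a) ÷ℕ d         ≡⟨ ÷ℕ-*-fromℕ b d a ⟨
  (b ÷ℕ d) *ℚ fromℕ a  ∎
  where open ≡-Reasoning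

÷ℕ-*-cancel : ∀ a {d} → 1 ≤ d → (a ÷ℕ d) *ℚ fromℕ d ≡ fromℕ a
÷ℕ-*-cancel a {suc d} _ =
  trans (÷ℕ-*-fromℕ a (suc d) (suc d)) (÷ℕ-cong (a * suc d) d a 0 (*-identityʳ (a * suc d)))

-- p′ = p · u / d, stated without division.
infix 4 _≡[_/_]_
record _≡[_/_]_ (p′ : ℚ) (u d : ℕ) (p : ℚ) : Set where
  constructor ratio
  field cross : p′ *ℚ fromℕ d ≡ p *ℚ fromℕ u
open _≡[_/_]_

ratio-* : ∀ {p p′ r r′ u v d e} → p′ ≡[ u / d ] p → r′ ≡[ v / e ] r → p′ *ℚ r′ ≡[ u * v / d * e ] p *ℚ r
ratio-* {p} {p′} {r} {r′} {u} {v} {d} {e} (ratio eq₁) (ratio eq₂) = ratio (begin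
  (p′ *ℚ r′) *ℚ fromℕ (d * e)              ≡⟨ cong ((p′ *ℚ r′) *ℚ_) (fromℕ-* d e) ⟩
  (p′ *ℚ r′) *ℚ (fromℕ d *ℚ fromℕ e)       ≡⟨ ℚ*.interchange p′ r′ (fromℕ d) (fromℕ e) ⟩
  (p′ *ℚ fromℕ d) *ℚ (r′ *ℚ fromℕ e)       ≡⟨ cong₂ _*ℚ_ eq₁ eq₂ ⟩
  (p *ℚ fromℕ u) *ℚ (r *ℚ fromℕ v)         ≡⟨ ℚ*.interchange p (fromℕ u) r (fromℕ v) ⟩
  (p *ℚ r) *ℚ (fromℕ u *ℚ fromℕ v)         ≡⟨ cong ((p *ℚ r) *ℚ_) (fromℕ-* u v) ⟨
  (p *ℚ r) *ℚ fromℕ (u * v)                ∎)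
  where open ≡-Reasoning

ratio<1⇒< : ∀ {p p′ u d} → Positive p → p′ ≡[ u / d ] p → u < d → p′ <ℚ p
ratio<1⇒< {p} {d = d} p>0 (ratio eq) u<d = ℚ.*-cancelʳ-<-nonNeg (fromℕ d) {{ℚ.normalize-nonNeg d 1}}
  (subst (_<ℚ p *ℚ fromℕ d) (sym eq) (ℚ.*-monoʳ-<-pos p {{p>0}} (fromℕ-< u<d)))

prodℚ-pos : ∀ k f → (∀ i → i < k → Positive (f i)) → Positive (prodℚ k f)
prodℚ-pos zero    f pos = _
prodℚ-pos (suc k) f pos = ℚ.pos*pos⇒pos (prodℚ k f) {{prodℚ-pos k f (λ i i<k → pos i (m<n⇒m<1+n i<k))}}
                                        (f k) {{pos k ≤-refl}}

powℚ-pos : ∀ p n → Positive p → Positive (powℚ p n)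
powℚ-pos p zero    p>0 = _
powℚ-pos p (suc n) p>0 = ℚ.pos*pos⇒pos (powℚ p n) {{powℚ-pos p n p>0}} p {{p>0}}

prodℚ-suc : ∀ f {n m} → n ≡ suc m → prodℚ n f ≡ prodℚ m f *ℚ f m
prodℚ-suc f refl = refl

powℚ-suc-∸ : ∀ p {t x} → t ≤ x → powℚ p (suc x ∸ t) ≡ powℚ p (x ∸ t) *ℚ p
powℚ-suc-∸ p t≤x = cong (powℚ p) (+-∸-assoc 1 t≤x)

-- Since suc n ∸ suc i = n ∸ i, raising the top index shifts all numerators by one place.
prodℚ-shift : ∀ (f d : ℕ → ℕ) n k →
              prodℚ k (λ i → f (suc n ∸ i) ÷ℕ d i) ≡[ f (suc n) / f (suc n ∸ k) ] prodℚ k (λ i → f (n ∸ i) ÷ℕ d i)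
prodℚ-shift f d n zero    = ratio refl
prodℚ-shift f d n (suc k) = ratio (begin
  (P′ *ℚ T′) *ℚ fromℕ (f (n ∸ k))          ≡⟨ ℚ.*-assoc P′ T′ _ ⟩
  P′ *ℚ (T′ *ℚ fromℕ (f (n ∸ k)))          ≡⟨ cong (P′ *ℚ_) (÷ℕ-*-fromℕ-comm (f (suc n ∸ k)) (f (n ∸ k)) (d k)) ⟩
  P′ *ℚ (T *ℚ fromℕ (f (suc n ∸ k)))       ≡⟨ ℚ*.x∙yz≈xz∙y P′ T _ ⟩
  (P′ *ℚ fromℕ (f (suc n ∸ k))) *ℚ T       ≡⟨ cong (_*ℚ T) (cross (prodℚ-shift f d n k)) ⟩
  (P *ℚ fromℕ (f (suc n))) *ℚ T            ≡⟨ ℚ*.xy∙z≈xz∙y P _ T ⟩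
  (P *ℚ T) *ℚ fromℕ (f (suc n))            ∎)
  where
  open ≡-Reasoning
  P′ = prodℚ k (λ i → f (suc n ∸ i) ÷ℕ d i)
  P  = prodℚ k (λ i → f (n ∸ i) ÷ℕ d i)
  T′ = f (suc n ∸ k) ÷ℕ d k
  T  = f (n ∸ k) ÷ℕ d k

pow∸1 : ℕ → ℕ → ℕ
pow∸1 q m = q ^ m ∸ 1

n≤2*[n∸1] : ∀ {n} → 2 ≤ n → n ≤ 2 * (n ∸ 1)
n≤2*[n∸1] {suc zero}    (s≤s ())
n≤2*[n∸1] {suc (suc k)} _        =
  ≤-trans (+-monoˡ-≤ (suc k) (s≤s z≤n)) (≤-reflexive (cong (_+_ (suc k)) (sym (+-identityʳ (suc k)))))

q≤q^m : ∀ {q m} → 2 ≤ q → 1 ≤ m → q ≤ q ^ m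
q≤q^m {q} (s≤s (s≤s _)) 1≤m = ≤-trans (≤-reflexive (sym (*-identityʳ q))) (^-monoʳ-≤ q 1≤m)

pow∸1-pos : ∀ {q} m → 2 ≤ q → 1 ≤ m → 1 ≤ pow∸1 q m
pow∸1-pos m q≥2 1≤m = ∸-monoˡ-≤ 1 (≤-trans q≥2 (q≤q^m q≥2 1≤m))

pow∸1-+-≤ : ∀ {q} i j → 2 ≤ q → 1 ≤ j → pow∸1 q (i + j) ≤ q ^ suc i * pow∸1 q j
pow∸1-+-≤ {q} i j q≥2 1≤j = begin
  q ^ (i + j) ∸ 1         ≤⟨ m∸n≤m _ 1 ⟩
  q ^ (i + j)             ≡⟨ ^-distribˡ-+-* q i j ⟩
  q ^ i * q ^ j           ≤⟨ *-monoʳ-≤ (q ^ i) (n≤2*[n∸1] (≤-trans q≥2 (q≤q^m q≥2 1≤j))) ⟩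
  q ^ i * (2 * pow∸1 q j) ≤⟨ *-monoʳ-≤ (q ^ i) (*-monoˡ-≤ (pow∸1 q j) q≥2) ⟩
  q ^ i * (q * pow∸1 q j) ≡⟨ solve 3 (λ x y z → x :* (y :* z) := y :* x :* z) refl (q ^ i) q (pow∸1 q j) ⟩
  q * q ^ i * pow∸1 q j   ∎
  where open ≤-Reasoning

pow∸1-*-^-< : ∀ {q m n} → 2 ≤ q → m < n → pow∸1 q m * q ^ n < q ^ m * pow∸1 q n
pow∸1-*-^-< {q} {m} {n} q≥2@(s≤s (s≤s _)) m<n = begin-strict
  (q ^ m ∸ 1) * q ^ n        ≡⟨ *-distribʳ-∸ (q ^ n) (q ^ m) 1 ⟩
  q ^ m * q ^ n ∸ 1 * q ^ n  <⟨ ∸-monoʳ-< q^m<q^n (*-monoˡ-≤ (q ^ n) (m^n>0 q m)) ⟩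
  q ^ m * q ^ n ∸ q ^ m * 1  ≡⟨ *-distribˡ-∸ (q ^ m) (q ^ n) 1 ⟨
  q ^ m * (q ^ n ∸ 1)        ∎
  where
  open ≤-Reasoning
  q^m<q^n : q ^ m * 1 < 1 * q ^ n
  q^m<q^n = subst₂ _<_ (sym (*-identityʳ _)) (sym (*-identityˡ _)) (^-monoʳ-< q q≥2 m<n)

pow∸1-product-< : ∀ {q} t a k m n → 2 ≤ q → 1 ≤ a → suc t + suc k + m ≤ n →
  pow∸1 q (t + a) * pow∸1 q (k + 1) * pow∸1 q m < pow∸1 q a * pow∸1 q 1 * pow∸1 q n
pow∸1-product-< {q} t a k m n q≥2@(s≤s (s≤s _)) 1≤a bound =
  *-cancelʳ-< (q ^ n) (pow∸1 q (t + a) * pow∸1 q (k + 1) * pow∸1 q m) R (begin-strict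
    pow∸1 q (t + a) * pow∸1 q (k + 1) * pow∸1 q m * q ^ n
      ≤⟨ *-monoˡ-≤ (q ^ n) (*-monoˡ-≤ (pow∸1 q m) (*-mono-≤ (pow∸1-+-≤ t a q≥2 1≤a) (pow∸1-+-≤ k 1 q≥2 ≤-refl))) ⟩
    (q ^ suc t * A) * (q ^ suc k * E) * pow∸1 q m * q ^ n
      ≡⟨ solve 6 (λ x y z w u v → (x :* z) :* (y :* w) :* u :* v := (x :* y :* z :* w) :* (u :* v))
               refl (q ^ suc t) (q ^ suc k) A E (pow∸1 q m) (q ^ n) ⟩
    W * (pow∸1 q m * q ^ n)
      <⟨ *-monoʳ-< W {{>-nonZero W>0}} (pow∸1-*-^-< q≥2 m<n) ⟩
    W * (q ^ m * pow∸1 q n)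
      ≡⟨ solve 6 (λ x y z w u v → (x :* y :* z :* w) :* (u :* v) := (x :* y :* u) :* (z :* w :* v))
               refl (q ^ suc t) (q ^ suc k) A E (q ^ m) (pow∸1 q n) ⟩
    q ^ suc t * q ^ suc k * q ^ m * R
      ≡⟨ cong (_* R) (sym (trans (^-distribˡ-+-* q (suc t + suc k) m) (cong (_* q ^ m) (^-distribˡ-+-* q (suc t) (suc k))))) ⟩
    q ^ (suc t + suc k + m) * R
      ≤⟨ *-monoˡ-≤ R (^-monoʳ-≤ q bound) ⟩
    q ^ n * R
      ≡⟨ *-comm (q ^ n) R ⟩
    R * q ^ n ∎)
  where
  open ≤-Reasoning
  A = pow∸1 q a
  E = pow∸1 q 1
  R = A * E * pow∸1 q n
  W = q ^ suc t * q ^ suc k * A * E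
  W>0 : W > 0
  W>0 = *-mono-≤ (*-mono-≤ (*-mono-≤ (m^n>0 q (suc t)) (m^n>0 q (suc k))) (pow∸1-pos a q≥2 1≤a)) (pow∸1-pos 1 q≥2 ≤-refl)
  m<n : m < n
  m<n = <-≤-trans (m<n+m m {suc t + suc k} (s≤s z≤n)) bound

c+1≤2[ν∸b] : ∀ {b c ν} → b ≤ ν → 2 * b + c + 1 ≤ 2 * ν → c + 1 ≤ 2 * (ν ∸ b)
c+1≤2[ν∸b] {b} {c} {ν} b≤ν h = +-cancelˡ-≤ (2 * b) (c + 1) (2 * (ν ∸ b)) (begin
  2 * b + (c + 1)        ≡⟨ +-assoc (2 * b) c 1 ⟨
  2 * b + c + 1          ≤⟨ h ⟩
  2 * ν                  ≡⟨ cong (2 *_) (m+[n∸m]≡n b≤ν) ⟨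
  2 * (b + (ν ∸ b))      ≡⟨ *-distribˡ-+ 2 b (ν ∸ b) ⟩
  2 * b + 2 * (ν ∸ b)    ∎)
  where open ≤-Reasoning

exponent-bound : ∀ {t c s} r → t ≤ c → 1 ≤ s → c + 1 ≤ 2 * r → suc t + suc (c ∸ t) + s ≤ 2 * (r + s)
exponent-bound {t} {c} {s} r t≤c 1≤s h = begin
  suc t + suc (c ∸ t) + s  ≡⟨ cong (λ z → suc z + s) (trans (+-suc t (c ∸ t)) (cong suc (m+[n∸m]≡n t≤c))) ⟩
  suc (suc c) + s          ≡⟨ solve 2 (λ x y → con 2 :+ x :+ y := (x :+ con 1) :+ (con 1 :+ y)) refl c s ⟩
  (c + 1) + (1 + s)        ≤⟨ +-mono-≤ h (+-monoˡ-≤ s 1≤s) ⟩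
  2 * r + (s + s)          ≡⟨ solve 2 (λ x y → con 2 :* x :+ (y :+ y) := con 2 :* (x :+ y)) refl r s ⟩
  2 * (r + s)              ∎
  where open ≤-Reasoning

gauss-pos : ∀ {q n k} → 2 ≤ q → k ≤ n → Positive (gauss q n k)
gauss-pos {n = n} {k} q≥2 k≤n = prodℚ-pos k _ λ i i<k →
  ÷ℕ-pos (pow∸1-pos (n ∸ i) q≥2 (m<n⇒0<n∸m (<-≤-trans i<k k≤n))) (pow∸1-pos (k ∸ i) q≥2 (m<n⇒0<n∸m i<k))

N′-pos : ∀ {q} a m ν → 2 ≤ q → Positive (N′ q a m ν)
N′-pos a m ν q≥2 = prodℚ-pos (m ∸ a) _ λ j _ →
  ÷ℕ-pos (pow∸1-pos (2 * (ν ∸ m + suc j)) q≥2 (≤-trans (s≤s z≤n) (≤-trans (m≤n+m (suc j) (ν ∸ m)) (m≤m+n _ _))))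
         (pow∸1-pos (suc j) q≥2 (s≤s z≤n))

g-pos : ∀ {q ν b c t x} → 2 ≤ q → t ≤ x → Positive (g q ν b c t x)
g-pos {q} {ν} {b} {c} {t} {x} q≥2 t≤x =
  ℚ.pos*pos⇒pos (G *ℚ Pw) {{ℚ.pos*pos⇒pos G {{gauss-pos q≥2 t≤x}} Pw {{Pw>0}}}} N {{N′-pos x b ν q≥2}}
  where
  G  = gauss q x t
  P  = gauss q (c ∸ t + 1) 1
  Pw = powℚ P (x ∸ t)
  N  = N′ q x b ν
  Pw>0 : Positive Pw
  Pw>0 = powℚ-pos P (x ∸ t) (gauss-pos q≥2 (m≤n+m 1 (c ∸ t)))

gauss-step : ∀ q n k → gauss q (suc n) k ≡[ pow∸1 q (suc n) / pow∸1 q (suc n ∸ k) ] gauss q n k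
gauss-step q n k = prodℚ-shift (pow∸1 q) (λ i → pow∸1 q (k ∸ i)) n k

gauss-1 : ∀ {q} n → 2 ≤ q → gauss q n 1 *ℚ fromℕ (pow∸1 q 1) ≡ fromℕ (pow∸1 q n)
gauss-1 {q} n q≥2 = begin
  (1ℚ *ℚ (pow∸1 q n ÷ℕ pow∸1 q 1)) *ℚ fromℕ (pow∸1 q 1)   ≡⟨ cong (_*ℚ fromℕ (pow∸1 q 1)) (ℚ.*-identityˡ (pow∸1 q n ÷ℕ pow∸1 q 1)) ⟩
  (pow∸1 q n ÷ℕ pow∸1 q 1) *ℚ fromℕ (pow∸1 q 1)           ≡⟨ ÷ℕ-*-cancel (pow∸1 q n) (pow∸1-pos 1 q≥2 ≤-refl) ⟩
  fromℕ (pow∸1 q n)                                        ∎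
  where open ≡-Reasoning

N′-step : ∀ {q} x b ν → 2 ≤ q → x < b →
          N′ q (suc x) b ν ≡[ pow∸1 q (b ∸ x) / pow∸1 q (2 * (ν ∸ b + (b ∸ x))) ] N′ q x b ν
N′-step {q} x b ν q≥2 x<b = subst
  (λ s → N′ q (suc x) b ν ≡[ pow∸1 q s / pow∸1 q (2 * (ν ∸ b + s)) ] N′ q x b ν)
  (sym b∸x≡1+m) (ratio (begin
    N′ q (suc x) b ν *ℚ fromℕ E                 ≡⟨ cong (N′ q (suc x) b ν *ℚ_) (÷ℕ-*-cancel E (pow∸1-pos (suc m) q≥2 (s≤s z≤n))) ⟨
    N′ q (suc x) b ν *ℚ ((E ÷ℕ F) *ℚ fromℕ F)   ≡⟨ ℚ.*-assoc (N′ q (suc x) b ν) (E ÷ℕ F) (fromℕ F) ⟨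
    (N′ q (suc x) b ν *ℚ (E ÷ℕ F)) *ℚ fromℕ F   ≡⟨ cong (_*ℚ fromℕ F) (prodℚ-suc _ b∸x≡1+m) ⟨
    N′ q x b ν *ℚ fromℕ F                       ∎))
  where
  open ≡-Reasoning
  m = b ∸ suc x
  b∸x≡1+m : b ∸ x ≡ suc m
  b∸x≡1+m = +-∸-assoc 1 x<b
  E = pow∸1 q (2 * (ν ∸ b + suc m))
  F = pow∸1 q (suc m)

g-ratio : ∀ {q ν b c t x} → 2 ≤ q → t ≤ x → x < b →
  g q ν b c t (suc x) ≡[ pow∸1 q (suc x) * pow∸1 q (c ∸ t + 1) * pow∸1 q (b ∸ x)
                       / pow∸1 q (suc x ∸ t) * pow∸1 q 1 * pow∸1 q (2 * (ν ∸ b + (b ∸ x))) ] g q ν b c t x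
g-ratio {q} {ν} {b} {c} {t} {x} q≥2 t≤x x<b =
  ratio-* (ratio-* (gauss-step q x t) power-step) (N′-step x b ν q≥2 x<b)
  where
  open ≡-Reasoning
  P = gauss q (c ∸ t + 1) 1
  power-step : powℚ P (suc x ∸ t) ≡[ pow∸1 q (c ∸ t + 1) / pow∸1 q 1 ] powℚ P (x ∸ t)
  power-step = ratio (begin
    powℚ P (suc x ∸ t) *ℚ fromℕ (pow∸1 q 1)      ≡⟨ cong (_*ℚ fromℕ (pow∸1 q 1)) (powℚ-suc-∸ P t≤x) ⟩
    powℚ P (x ∸ t) *ℚ P *ℚ fromℕ (pow∸1 q 1)     ≡⟨ ℚ.*-assoc (powℚ P (x ∸ t)) P (fromℕ (pow∸1 q 1)) ⟩
    powℚ P (x ∸ t) *ℚ (P *ℚ fromℕ (pow∸1 q 1))   ≡⟨ cong (powℚ P (x ∸ t) *ℚ_) (gauss-1 (c ∸ t + 1) q≥2) ⟩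
    powℚ P (x ∸ t) *ℚ fromℕ (pow∸1 q (c ∸ t + 1)) ∎)

g-step : ∀ {q ν b c t} → 2 ≤ q → t ≤ c → b ≤ ν → 2 * b + c + 1 ≤ 2 * ν →
         ∀ x → t ≤ x → suc x ≤ b → g q ν b c t (suc x) <ℚ g q ν b c t x
g-step {q} {ν} {b} {c} {t} q≥2 t≤c b≤ν h x t≤x x<b =
  ratio<1⇒< (g-pos q≥2 t≤x) (g-ratio q≥2 t≤x x<b) numerator<denominator
  where
  D = pow∸1 q (suc x ∸ t) * pow∸1 q 1 * pow∸1 q (2 * (ν ∸ b + (b ∸ x)))
  numerator<denominator : pow∸1 q (suc x) * pow∸1 q (c ∸ t + 1) * pow∸1 q (b ∸ x) < D
  numerator<denominator =
    subst (λ z → pow∸1 q z * pow∸1 q (c ∸ t + 1) * pow∸1 q (b ∸ x) < D) (m+[n∸m]≡n (m≤n⇒m≤1+n t≤x))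
      (pow∸1-product-< t (suc x ∸ t) (c ∸ t) (b ∸ x) (2 * (ν ∸ b + (b ∸ x))) q≥2 (m<n⇒0<n∸m (s≤s t≤x))
        (exponent-bound (ν ∸ b) t≤c (m<n⇒0<n∸m x<b) (c+1≤2[ν∸b] b≤ν h)))

stepwise-decreasing⇒decreasing : ∀ {a ℓ} {A : Set a} {_≺_ : A → A → Set ℓ} → Transitive _≺_ →
  (f : ℕ → A) {lo hi : ℕ} → (∀ x → lo ≤ x → suc x ≤ hi → f (suc x) ≺ f x) →
  ∀ {x y} → lo ≤ x → x < y → y ≤ hi → f y ≺ f x
stepwise-decreasing⇒decreasing {_≺_ = _≺_} ≺-trans f {lo} {hi} step {x} lo≤x x<y = go (≤⇒≤′ x<y)
  where
  go : ∀ {y} → suc x ≤′ y → y ≤ hi → f y ≺ f x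
  go ≤′-refl           y≤hi  = step x lo≤x y≤hi
  go (≤′-step {y} x<y) sy≤hi =
    ≺-trans (step y (≤-trans lo≤x (<⇒≤ (≤′⇒≤ x<y))) sy≤hi) (go x<y (≤-trans (n≤1+n y) sy≤hi))

IsPrimePower⇒2≤ : ∀ {q} → IsPrimePower q → 2 ≤ q
IsPrimePower⇒2≤ (p , k , p-prime , 1≤k , refl) = ≤-trans 2≤p (q≤q^m 2≤p 1≤k)
  where
  2≤p : 2 ≤ p
  2≤p = nonTrivial⇒n>1 p {{prime⇒nonTrivial p-prime}}

lemma3p1 : (q ν b c t : ℕ) → IsPrimePower q →
    1 ≤ ν → 1 ≤ b → 1 ≤ c → 1 ≤ t →
    2 * ν ≥ 2 * b + c + 1 → ν > b → b ≥ t + 1 → c ≥ t →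
    (x y : ℕ) → t ≤ x → x < y → y ≤ b →
    g q ν b c t y <ℚ g q ν b c t x
lemma3p1 q ν b c t q-pp _ _ _ _ h ν>b _ c≥t x y t≤x x<y y≤b =
  stepwise-decreasing⇒decreasing {_≺_ = _<ℚ_} ℚ.<-trans (g q ν b c t)
    (g-step (IsPrimePower⇒2≤ q-pp) c≥t (<⇒≤ ν>b) h) t≤x x<y y≤b
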